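{- For every finite simple graph $G$, $\iota_2(G)\le\frac{\omega(G)+\Delta(G)+1}{2}$.
   Context: A $2$-bounded coloring of $G$ is a proper coloring in which every color class has at most $2$ vertices; an optimal $2$-bounded coloring is one with the minimum possible number of color classes. $\iota_2(G)$ is the maximum number of singleton color classes in an optimal $2$-bounded coloring of $G$. $\omega(G)$, $\Delta(G)$ are the clique number and maximum degree. -}

module Defs where

open import Data.Nat using (ℕ; zero; suc; _≤_; _⊔_)
open import Data.Bool using (Bool; true; false; T)
open import Data.Fin using (Fin; _≟_)
open import Data.List using (List; length; filter; map; foldr; allFin)
open import Data.List.Relation.Unary.Unique.Propositional using (Unique)
open import Data.List.Membership.Propositional using (_∈_)
open import Data.Product using (Σ; _×_; ∃)
open import Function using (Surjective)
open import Relation.Binary.PropositionalEquality using (_≡_)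
open import Relation.Nullary using (¬_)
open import Relation.Nullary.Decidable using (does)

record Graph (n : ℕ) : Set where
  field
    adj    : Fin n → Fin n → Bool
    sym    : ∀ u v → adj u v ≡ adj v u
    irrefl : ∀ v → adj v v ≡ false
open Graph public

Adj : ∀ {n} → Graph n → Fin n → Fin n → Set
Adj G u v = T (adj G u v)

degree : ∀ {n} → Graph n → Fin n → ℕ
degree {n} G v = length (filter (λ u → T? (adj G v u)) (allFin n))
  where
  open import Data.Bool using (T?)

maxDegree : ∀ {n} → Graph n → ℕ
maxDegree {n} G = foldr _⊔_ 0 (map (degree G) (allFin n))

IsClique : ∀ {n} → Graph n → List (Fin n) → Set
IsClique G K = Unique K × (∀ u v → u ∈ K → v ∈ K → ¬ u ≡ v → Adj G u v)

IsCliqueNumber : ∀ {n} → Graph n → ℕ → Set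
IsCliqueNumber G ω =
  Σ (List _) (λ K → IsClique G K × length K ≡ ω)
  × (∀ K → IsClique G K → length K ≤ ω)

classSize : ∀ {n k} → (Fin n → Fin k) → Fin k → ℕ
classSize {n} c j = length (filter (λ v → c v ≟ j) (allFin n))

-- A 2-bounded coloring of G with exactly k (nonempty) color classes:
-- a proper coloring c onto Fin k in which every class has ≤ 2 vertices.
record TwoBoundedColoring {n} (G : Graph n) (k : ℕ) : Set where
  field
    col     : Fin n → Fin k
    proper  : ∀ u v → Adj G u v → ¬ col u ≡ col v
    onto    : Surjective _≡_ _≡_ col
    bounded : ∀ j → classSize col j ≤ 2
open TwoBoundedColoring public

IsOptimal : ∀ {n} (G : Graph n) {k} → TwoBoundedColoring G k → Set
IsOptimal G {k} _ = ∀ k' → TwoBoundedColoring G k' → k ≤ k'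

singletons : ∀ {n k} {G : Graph n} → TwoBoundedColoring G k → ℕ
singletons {k = k} C =
  length (filter (λ j → classSize (col C) j Data.Nat.≟ 1) (allFin k))
  where import Data.Nat

IsIota2 : ∀ {n} → Graph n → ℕ → Set
IsIota2 G ι =
  Σ ℕ (λ k → Σ (TwoBoundedColoring G k) (λ C → IsOptimal G C × singletons C ≡ ι))
  × (∀ k (C : TwoBoundedColoring G k) → IsOptimal G C → singletons C ≤ ι)

-- If two singleton classes {a} and {b} of an optimal 2-bounded coloring had
-- a and b non-adjacent, merging them into one class {a, b} would save a
-- color. So the vertices of singleton classes form a clique S. Hence
-- |S| ≤ ω, and since S ⊆ {u} ∪ N(u) for any u ∈ S, also |S| ≤ Δ + 1;
-- adding the two bounds gives 2 ι₂ ≤ ω + Δ + 1.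
module Submission where

open import Defs hiding (sym)
open import Data.Nat using (ℕ; zero; suc; z≤n; s≤s; _≤_; _+_; _*_; _⊔_) renaming (_≟_ to _≟ℕ_)
open import Data.Nat.Properties
  using (≤-trans; m≤m⊔n; m≤n⊔m; n≮n; +-mono-≤; +-comm; +-assoc; +-identityʳ; module ≤-Reasoning)
open import Data.Fin using (Fin; _≟_; punchIn; punchOut)
open import Data.Fin.Properties using (punchOut-injective; punchOut-punchIn; punchIn-punchOut; punchInᵢ≢i)
open import Data.Bool using (T; T?)
open import Data.List using (List; []; _∷_; _++_; length; filter; map; foldr; allFin)
open import Data.List.Properties using (filter-notAll; length-map; length-++)
open import Data.List.Relation.Unary.All using ([]; _∷_)
import Data.List.Relation.Unary.All as All
open import Data.List.Relation.Unary.Any using (here; there)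
import Data.List.Relation.Unary.Any as Any
open import Data.List.Relation.Unary.AllPairs using ([]; _∷_)
open import Data.List.Relation.Unary.Unique.Propositional using (Unique)
import Data.List.Relation.Unary.Unique.Propositional.Properties as Unique
open import Data.List.Membership.Propositional using (_∈_)
open import Data.List.Membership.Propositional.Properties
  using (∈-filter⁺; ∈-filter⁻; ∈-allFin; ∈-map⁻; ∈-++⁺ˡ; ∈-++⁺ʳ)
open import Data.Product using (_×_; _,_; proj₁; proj₂)
open import Data.Sum using (_⊎_; inj₁; inj₂)
open import Data.Empty using (⊥-elim)
open import Function using (_∘_; Surjective)
open import Relation.Binary.Definitions using (DecidableEquality)
open import Relation.Binary.PropositionalEquality
  using (_≡_; _≢_; refl; sym; trans; cong; cong₂; subst; subst₂)
open import Relation.Nullary using (¬_; yes; no; ¬?)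

module _ {A : Set} (_≟ᴬ_ : DecidableEquality A) where

  Unique⊆⇒length≤ : ∀ {xs ys : List A} → Unique xs → (∀ {x} → x ∈ xs → x ∈ ys) →
                    length xs ≤ length ys
  Unique⊆⇒length≤ {[]}     _            _  = z≤n
  Unique⊆⇒length≤ {x ∷ xs} {ys} (x∉xs ∷ xs!) xs⊆ys =
    ≤-trans (s≤s (Unique⊆⇒length≤ xs! xs⊆ys-x)) (filter-notAll ≢x? ys x∈ys)
    where
    ≢x? = λ y → ¬? (x ≟ᴬ y)
    xs⊆ys-x : ∀ {z} → z ∈ xs → z ∈ filter ≢x? ys
    xs⊆ys-x z∈xs = ∈-filter⁺ ≢x? (xs⊆ys (there z∈xs)) (All.lookup x∉xs z∈xs)
    x∈ys = Any.map (λ x≡y x≢y → x≢y x≡y) (xs⊆ys (here refl))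

foldr-⊔-upperBound : ∀ {A : Set} (f : A → ℕ) {x} {xs : List A} → x ∈ xs →
                     f x ≤ foldr _⊔_ 0 (map f xs)
foldr-⊔-upperBound f (here refl)             = m≤m⊔n _ _
foldr-⊔-upperBound f {xs = y ∷ _} (there x∈xs) = ≤-trans (foldr-⊔-upperBound f x∈xs) (m≤n⊔m (f y) _)

module _ {n k : ℕ} (c : Fin n → Fin k) where

  colorClass : Fin k → List (Fin n)
  colorClass j = filter (λ v → c v ≟ j) (allFin n)

  ∈-colorClass : ∀ {v j} → c v ≡ j → v ∈ colorClass j
  ∈-colorClass {v} = ∈-filter⁺ (λ w → c w ≟ _) (∈-allFin v)

  classSize≤ : ∀ j {ys} → (∀ {v} → c v ≡ j → v ∈ ys) → classSize c j ≤ length ys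
  classSize≤ j class⊆ys = Unique⊆⇒length≤ _≟_ (Unique.filter⁺ c≟j (Unique.allFin⁺ n))
                            (λ v∈ → class⊆ys (proj₂ (∈-filter⁻ c≟j {xs = allFin n} v∈)))
    where c≟j = λ w → c w ≟ j

  singletonClass-unique : ∀ {j x y} → classSize c j ≡ 1 → c x ≡ j → c y ≡ j → x ≡ y
  singletonClass-unique {j} {x} {y} size≡1 cx cy with x ≟ y
  ... | yes x≡y = x≡y
  ... | no  x≢y = ⊥-elim (n≮n 1 (subst (2 ≤_) size≡1 two≤size))
    where
    two≤size : 2 ≤ classSize c j
    two≤size = Unique⊆⇒length≤ _≟_ ((x≢y ∷ []) ∷ [] ∷ [])
      λ { (here refl) → ∈-colorClass cx ; (there (here refl)) → ∈-colorClass cy }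

module MergeColors {k} (i j : Fin (suc k)) (i≢j : i ≢ j) where

  redirect : Fin (suc k) → Fin (suc k)
  redirect x with x ≟ j
  ... | yes _ = i
  ... | no  _ = x

  j≢redirect : ∀ x → j ≢ redirect x
  j≢redirect x with x ≟ j
  ... | yes _   = λ j≡i → i≢j (sym j≡i)
  ... | no  x≢j = λ j≡x → x≢j (sym j≡x)

  merge : Fin (suc k) → Fin k
  merge x = punchOut (j≢redirect x)

  merge-punchIn : ∀ m → merge (punchIn j m) ≡ m
  merge-punchIn m with punchIn j m ≟ j
  ... | yes p≡j = ⊥-elim (punchInᵢ≢i j m p≡j)
  ... | no  _   = punchOut-punchIn j

  redirect⁻¹ : ∀ {x t} → redirect x ≡ t → x ≡ t ⊎ (x ≡ j × i ≡ t)
  redirect⁻¹ {x} r≡t with x ≟ j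
  ... | yes x≡j = inj₂ (x≡j , r≡t)
  ... | no  _   = inj₁ r≡t

  merge⁻¹ : ∀ {x m} → merge x ≡ m → x ≡ punchIn j m ⊎ (x ≡ j × i ≡ punchIn j m)
  merge⁻¹ {x} refl = redirect⁻¹ (sym (punchIn-punchOut (j≢redirect x)))

  redirect-collision : ∀ {x y} → redirect x ≡ redirect y → x ≡ y ⊎ (x ≡ j × y ≡ i) ⊎ (x ≡ i × y ≡ j)
  redirect-collision {x} {y} eq with x ≟ j | y ≟ j
  ... | yes x≡j | yes y≡j = inj₁ (trans x≡j (sym y≡j))
  ... | yes x≡j | no  _   = inj₂ (inj₁ (x≡j , sym eq))
  ... | no  _   | yes y≡j = inj₂ (inj₂ (eq , y≡j))
  ... | no  _   | no  _   = inj₁ eq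

  merge-collision : ∀ {x y} → merge x ≡ merge y → x ≡ y ⊎ (x ≡ j × y ≡ i) ⊎ (x ≡ i × y ≡ j)
  merge-collision {x} {y} = redirect-collision ∘ punchOut-injective (j≢redirect x) (j≢redirect y)

Adj-sym : ∀ {n} (G : Graph n) {u v} → Adj G u v → Adj G v u
Adj-sym G {u} {v} = subst T (Graph.sym G u v)

degree≤maxDegree : ∀ {n} (G : Graph n) v → degree G v ≤ maxDegree G
degree≤maxDegree G v = foldr-⊔-upperBound (degree G) (∈-allFin v)

clique-length≤1+maxDegree : ∀ {n} (G : Graph n) {K} → IsClique G K → length K ≤ suc (maxDegree G)
clique-length≤1+maxDegree G {[]}    _            = z≤n
clique-length≤1+maxDegree {n} G {u ∷ K} (uK! , uK-adj) = begin
  length (u ∷ K)   ≤⟨ Unique⊆⇒length≤ _≟_ uK! ⊆closedNeighbourhood ⟩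
  suc (degree G u) ≤⟨ s≤s (degree≤maxDegree G u) ⟩
  suc (maxDegree G) ∎
  where
  open ≤-Reasoning
  adj? = λ w → T? (adj G u w)
  ⊆closedNeighbourhood : ∀ {x} → x ∈ u ∷ K → x ∈ u ∷ filter adj? (allFin n)
  ⊆closedNeighbourhood {x} x∈uK with x ≟ u
  ... | yes x≡u = here x≡u
  ... | no  x≢u = there (∈-filter⁺ adj? (∈-allFin x) (uK-adj u x (here refl) x∈uK (x≢u ∘ sym)))

module MergeSingletons {n} {G : Graph n} {k} (C : TwoBoundedColoring G (suc k))
  {a b : Fin n} (a≢b : a ≢ b) (a≁b : ¬ Adj G a b)
  (a-alone : classSize (col C) (col C a) ≡ 1) (b-alone : classSize (col C) (col C b) ≡ 1) where

  private
    c = col C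

    only-a : ∀ {w} → c w ≡ c a → w ≡ a
    only-a cw≡ = singletonClass-unique c a-alone cw≡ refl

    only-b : ∀ {w} → c w ≡ c b → w ≡ b
    only-b cw≡ = singletonClass-unique c b-alone cw≡ refl

    ca≢cb : c a ≢ c b
    ca≢cb = a≢b ∘ only-b

  open MergeColors (c a) (c b) ca≢cb

  merged-proper : ∀ u v → Adj G u v → merge (c u) ≢ merge (c v)
  merged-proper u v u~v eq with merge-collision eq
  ... | inj₁ cu≡cv                = proper C u v u~v cu≡cv
  ... | inj₂ (inj₁ (cu≡cb , cv≡ca)) =
    a≁b (subst₂ (Adj G) (only-a cv≡ca) (only-b cu≡cb) (Adj-sym G u~v))
  ... | inj₂ (inj₂ (cu≡ca , cv≡cb)) =
    a≁b (subst₂ (Adj G) (only-a cu≡ca) (only-b cv≡cb) u~v)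

  merged-onto : Surjective _≡_ _≡_ (merge ∘ c)
  merged-onto m with onto C (punchIn (c b) m)
  ... | w , cw≡ = w , λ { refl → trans (cong merge (cw≡ refl)) (merge-punchIn m) }

  merged-bounded : ∀ m → classSize (merge ∘ c) m ≤ 2
  merged-bounded m with punchIn (c b) m ≟ c a
  ... | yes m⁺≡ca = begin
    classSize (merge ∘ c) m                           ≤⟨ classSize≤ (merge ∘ c) m ⊆a∪b ⟩
    length (colorClass c (c a) ++ colorClass c (c b)) ≡⟨ length-++ (colorClass c (c a)) ⟩
    classSize c (c a) + classSize c (c b)             ≡⟨ cong₂ _+_ a-alone b-alone ⟩
    2                                                 ∎
    where
    open ≤-Reasoning
    ⊆a∪b : ∀ {v} → merge (c v) ≡ m → v ∈ colorClass c (c a) ++ colorClass c (c b)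
    ⊆a∪b cv↦m with merge⁻¹ cv↦m
    ... | inj₁ cv≡m⁺       = ∈-++⁺ˡ (∈-colorClass c (trans cv≡m⁺ m⁺≡ca))
    ... | inj₂ (cv≡cb , _) = ∈-++⁺ʳ _ (∈-colorClass c cv≡cb)
  ... | no m⁺≢ca = ≤-trans (classSize≤ (merge ∘ c) m ⊆m⁺) (bounded C (punchIn (c b) m))
    where
    ⊆m⁺ : ∀ {v} → merge (c v) ≡ m → v ∈ colorClass c (punchIn (c b) m)
    ⊆m⁺ cv↦m with merge⁻¹ cv↦m
    ... | inj₁ cv≡m⁺       = ∈-colorClass c cv≡m⁺
    ... | inj₂ (_ , ca≡m⁺) = ⊥-elim (m⁺≢ca (sym ca≡m⁺))

  mergeSingletons : TwoBoundedColoring G k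
  mergeSingletons = record
    { col     = merge ∘ c
    ; proper  = merged-proper
    ; onto    = merged-onto
    ; bounded = merged-bounded
    }

optimal⇒singletons-adjacent : ∀ {n} {G : Graph n} {k} (C : TwoBoundedColoring G k) → IsOptimal G C →
  ∀ {u v} → u ≢ v → classSize (col C) (col C u) ≡ 1 → classSize (col C) (col C v) ≡ 1 → Adj G u v
optimal⇒singletons-adjacent {k = zero} C _ {u} _ _ _ with col C u
... | ()
optimal⇒singletons-adjacent {G = G} {suc k} C optimal {u} {v} u≢v u-alone v-alone with T? (adj G u v)
... | yes u~v = u~v
... | no  u≁v = ⊥-elim (n≮n k (optimal k (mergeSingletons C u≢v u≁v u-alone v-alone)))
  where open MergeSingletons

module SingletonVertices {n} {G : Graph n} {k} (C : TwoBoundedColoring G k) where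

  private
    c = col C

    representative : Fin k → Fin n
    representative j = proj₁ (onto C j)

    col-representative : ∀ j → c (representative j) ≡ j
    col-representative j = proj₂ (onto C j) refl

    singletonColors : List (Fin k)
    singletonColors = filter (λ j → classSize c j ≟ℕ 1) (allFin k)

  singletonVertices : List (Fin n)
  singletonVertices = map representative singletonColors

  length-singletonVertices : length singletonVertices ≡ singletons C
  length-singletonVertices = length-map representative singletonColors

  singletonVertices-Unique : Unique singletonVertices
  singletonVertices-Unique =
    Unique.map⁺ representative-injective (Unique.filter⁺ (λ j → classSize c j ≟ℕ 1) (Unique.allFin⁺ k))
    where
    representative-injective : ∀ {i j} → representative i ≡ representative j → i ≡ j
    representative-injective {i} {j} eq =
      trans (sym (col-representative i)) (trans (cong c eq) (col-representative j))

  singletonVertices-alone : ∀ {v} → v ∈ singletonVertices → classSize c (c v) ≡ 1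
  singletonVertices-alone v∈ with ∈-map⁻ representative v∈
  ... | j , j∈ , refl = subst (λ t → classSize c t ≡ 1) (sym (col-representative j))
                              (proj₂ (∈-filter⁻ (λ j → classSize c j ≟ℕ 1) {xs = allFin k} j∈))

  optimal⇒singletonVertices-clique : IsOptimal G C → IsClique G singletonVertices
  optimal⇒singletonVertices-clique optimal = singletonVertices-Unique , λ u v u∈ v∈ u≢v →
    optimal⇒singletons-adjacent C optimal u≢v (singletonVertices-alone u∈) (singletonVertices-alone v∈)

corollary6p8 : ∀ (n : ℕ) (G : Graph n) (ι ω : ℕ) →
    IsIota2 G ι → IsCliqueNumber G ω →
    2 * ι ≤ ω + maxDegree G + 1
corollary6p8 n G .(singletons C) ω ((k , C , optimal , refl) , _) (_ , ω-max) = begin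
  2 * s              ≡⟨ cong (s +_) (+-identityʳ s) ⟩
  s + s              ≤⟨ +-mono-≤ s≤ω s≤1+Δ ⟩
  ω + suc Δ          ≡⟨ cong (ω +_) (+-comm 1 Δ) ⟩
  ω + (Δ + 1)        ≡⟨ sym (+-assoc ω Δ 1) ⟩
  ω + Δ + 1          ∎
  where
  open ≤-Reasoning
  open SingletonVertices C
  s = singletons C
  Δ = maxDegree G
  S-clique = optimal⇒singletonVertices-clique optimal
  s≤ω : s ≤ ω
  s≤ω = subst (_≤ ω) length-singletonVertices (ω-max singletonVertices S-clique)
  s≤1+Δ : s ≤ suc Δ
  s≤1+Δ = subst (_≤ suc Δ) length-singletonVertices (clique-length≤1+maxDegree G S-clique)
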